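{- Let $H$ be a subgraph of a finite simple graph $G$. Then $\nu_*(H)\le\nu_*(G)$, and if moreover $V(H)=V(G)$, then $\nu^*(H)\le\nu^*(G)$.
   Context: For a finite simple graph $G=(V,E)$ with $p=|V|$, $q=|E|$, $\ell=p+q$, a construction sequence (c-sequence) for $G$ is a bijection $x:\{1,\dots,\ell\}\to V\sqcup E$ such that for every edge $e=uw$, $x^{ -1}(e)>\max\{x^{ -1}(u),x^{ -1}(w)\}$. The cost of an edge $e=uw$ in $x$ is $\nu(e,x)=(x^{ -1}(e)-x^{ -1}(u))+(x^{ -1}(e)-x^{ -1}(w))$, and the cost of $x$ is $\nu(x)=\sum_{e\in E}\nu(e,x)$. The max and min costs are $\nu^*(G)=\max\nu(x)$ and $\nu_*(G)=\min\nu(x)$ over all c-sequences $x$ for $G$. -}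

module Defs where

open import Data.Nat using (ℕ; _+_; _*_; _∸_; _<_; _≤_)
open import Data.Fin using (Fin; toℕ)
open import Data.Fin.Properties using ()
open import Data.Product using (_×_; _,_; proj₁; proj₂; Σ; ∃)
open import Data.Sum using (_⊎_; inj₁; inj₂)
open import Data.Vec.Functional using (foldr)
open import Function.Bundles using (_↔_; Inverse)
open import Relation.Binary.PropositionalEquality using (_≡_; _≢_)

record Graph : Set where
  field
    p    : ℕ
    q    : ℕ
    ends : Fin q → Fin p × Fin p
    loopless : ∀ e → proj₁ (ends e) ≢ proj₂ (ends e)
    simple : ∀ e e′ →
      ((proj₁ (ends e) ≡ proj₁ (ends e′) × proj₂ (ends e) ≡ proj₂ (ends e′))
        ⊎ (proj₁ (ends e) ≡ proj₂ (ends e′) × proj₂ (ends e) ≡ proj₁ (ends e′)))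
      → e ≡ e′
open Graph public

Elt : Graph → Set
Elt G = Fin (p G) ⊎ Fin (q G)

len : Graph → ℕ
len G = p G + q G

-- A construction sequence: a bijection x : {1..ℓ} → V ⊔ E (positions are
-- 0-indexed here, which does not affect costs) such that every edge comes
-- after both of its endpoints.
record CSeq (G : Graph) : Set where
  field
    x : Fin (len G) ↔ Elt G
  pos : Elt G → ℕ
  pos a = toℕ (Inverse.from x a)
  field
    edge-after : ∀ e →
      pos (inj₁ (proj₁ (ends G e))) < pos (inj₂ e) ×
      pos (inj₁ (proj₂ (ends G e))) < pos (inj₂ e)
open CSeq public

edgeCost : {G : Graph} → CSeq G → Fin (q G) → ℕ
edgeCost {G} c e =
  (pos c (inj₂ e) ∸ pos c (inj₁ (proj₁ (ends G e)))) +
  (pos c (inj₂ e) ∸ pos c (inj₁ (proj₂ (ends G e))))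

cost : {G : Graph} → CSeq G → ℕ
cost {G} c = foldr _+_ 0 (edgeCost c)

IsMinCost : Graph → ℕ → Set
IsMinCost G m = Σ (CSeq G) (λ c → cost c ≡ m) × (∀ (c : CSeq G) → m ≤ cost c)

IsMaxCost : Graph → ℕ → Set
IsMaxCost G m = Σ (CSeq G) (λ c → cost c ≡ m) × (∀ (c : CSeq G) → cost c ≤ m)

-- H is a subgraph of G (up to relabelling): an injective vertex map f and an
-- injective edge map g such that every edge of H with ends (u , w) is sent to
-- an edge of G with ends {f u , f w}.
record Subgraph (H G : Graph) : Set where
  field
    f     : Fin (p H) → Fin (p G)
    f-inj : ∀ u v → f u ≡ f v → u ≡ v
    g     : Fin (q H) → Fin (q G)
    g-inj : ∀ e e′ → g e ≡ g e′ → e ≡ e′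
    g-ends : ∀ e →
      (proj₁ (ends G (g e)) ≡ f (proj₁ (ends H e)) × proj₂ (ends G (g e)) ≡ f (proj₂ (ends H e)))
      ⊎ (proj₁ (ends G (g e)) ≡ f (proj₂ (ends H e)) × proj₂ (ends G (g e)) ≡ f (proj₁ (ends H e)))
open Subgraph public

Spanning : {H G : Graph} → Subgraph H G → Set
Spanning {H} {G} s = ∀ (v : Fin (p G)) → ∃ (λ u → f s u ≡ v)

-- Both inequalities compare a c-sequence x of H with a c-sequence y of G that lists the
-- elements of H in the same relative order, and in which every gap pos e − pos u of H is
-- at most the corresponding gap of G; since edges of H inject into edges of G, this gives
-- ν(x) ≤ ν(y). For ν_*, take an optimal y and let x sort H by the y-positions: deleting
-- the elements outside H can only shrink gaps. For ν^*, take an optimal x and let y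
-- append the edges outside H after it, in any order; this is a c-sequence of G only
-- because V(H) = V(G), so every vertex already precedes them, and it keeps every gap of H.

module Submission where

open import Defs
open import Data.Nat using (ℕ; zero; suc; _+_; _∸_; _≤_; _<_; z≤n; s≤s; z<s)
open import Data.Nat.Properties
  using ( ≤-refl; ≤-trans; <⇒≤; <⇒≢; <⇒≯; <-≤-trans; <-cmp; 1+n≰n; m≤m+n; +-comm; +-cancelˡ-≡
        ; +-mono-≤; +-monoʳ-≤; +-mono-<-≤; m+[n∸m]≡n; m+n∸m≡n; +-0-commutativeMonoid; module ≤-Reasoning)
open import Data.Fin using (Fin; zero; suc; toℕ; fromℕ<; punchIn; punchOut; _≟_)
open import Data.Fin.Properties
  using (toℕ-fromℕ<; toℕ-injective; toℕ<n; suc-injective; 0≢1+n; punchIn-punchOut; punchOut-injective; any?; injective⇒≤; +↔⊎)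
open import Data.Product using (_×_; _,_; proj₁; proj₂; ∃)
import Data.Product as Product
open import Data.Sum using (_⊎_; inj₁; inj₂)
import Data.Sum as Sum
open import Data.Sum.Properties using (inj₁-injective; inj₂-injective; ≡-dec)
open import Data.Vec.Functional using (Vector; removeAt)
open import Function using (_∘_; _↔_; Inverse; mk↔ₛ′; Injection; Injective; _⇔_; mk⇔; Equivalence)
open import Function.Properties.Inverse using (↔⇒↣; ↔-sym)
open import Relation.Binary.Definitions using (Symmetric; DecidableEquality; tri<; tri≈; tri>)
open import Relation.Binary.PropositionalEquality
  using (_≡_; _≢_; refl; sym; trans; cong; cong₂; subst; subst₂; module ≡-Reasoning)
open import Relation.Nullary using (Dec; yes; no; contradiction)
open import Relation.Nullary.Decidable using (map′)
open import Algebra.Properties.CommutativeMonoid.Sum +-0-commutativeMonoid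
  using (sum; sum-remove; ∑-distrib-+; sum-cong-≗; sum-replicate-zero)

sum-mono-≤ : ∀ {n} {u v : Vector ℕ n} → (∀ i → u i ≤ v i) → sum u ≤ sum v
sum-mono-≤ {zero}  _   = z≤n
sum-mono-≤ {suc n} u≤v = +-mono-≤ (u≤v zero) (sum-mono-≤ (u≤v ∘ suc))

sum-mono-< : ∀ {n} {u v : Vector ℕ n} → (∀ i → u i ≤ v i) → ∀ j → u j < v j → sum u < sum v
sum-mono-< {suc n} {u} {v} u≤v j uj<vj = begin-strict
  sum u                    ≡⟨ sum-remove u ⟩
  u j + sum (removeAt u j) <⟨ +-mono-<-≤ uj<vj (sum-mono-≤ (u≤v ∘ punchIn j)) ⟩
  v j + sum (removeAt v j) ≡⟨ sum-remove v ⟨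
  sum v                    ∎
  where open ≤-Reasoning

sum-inject-≤ : ∀ {m n} (w : Vector ℕ n) {h : Fin m → Fin n} → Injective _≡_ _≡_ h → sum (w ∘ h) ≤ sum w
sum-inject-≤ {zero}          w     _     = z≤n
sum-inject-≤ {suc m} {zero}  w {h} _     = contradiction (h zero) λ ()
sum-inject-≤ {suc m} {suc n} w {h} h-inj = begin
  w h₀ + sum (w ∘ h ∘ suc)        ≡⟨ cong (w h₀ +_) (sum-cong-≗ (cong w ∘ sym ∘ punchIn-punchOut ∘ h₀≢)) ⟩
  w h₀ + sum (removeAt w h₀ ∘ h′) ≤⟨ +-monoʳ-≤ (w h₀) (sum-inject-≤ (removeAt w h₀) h′-inj) ⟩
  w h₀ + sum (removeAt w h₀)      ≡⟨ sum-remove w ⟨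
  sum w                           ∎
  where
  open ≤-Reasoning
  h₀ : Fin (suc n)
  h₀ = h zero
  h₀≢ : ∀ i → h₀ ≢ h (suc i)
  h₀≢ i = 0≢1+n ∘ h-inj
  h′ : Fin m → Fin n
  h′ i = punchOut (h₀≢ i)
  h′-inj : Injective _≡_ _≡_ h′
  h′-inj {i} {j} eq = suc-injective (h-inj (punchOut-injective (h₀≢ i) (h₀≢ j) eq))

sum-∸ : ∀ {n} {u v : Vector ℕ n} → (∀ i → v i ≤ u i) → sum (λ i → u i ∸ v i) ≡ sum u ∸ sum v
sum-∸ {u = u} {v} v≤u = sym (begin
  sum u ∸ sum v                         ≡⟨ cong (_∸ sum v) (sum-cong-≗ (sym ∘ m+[n∸m]≡n ∘ v≤u)) ⟩
  sum (λ i → v i + (u i ∸ v i)) ∸ sum v ≡⟨ cong (_∸ sum v) (∑-distrib-+ v _) ⟩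
  sum v + sum (λ i → u i ∸ v i) ∸ sum v ≡⟨ m+n∸m≡n (sum v) _ ⟩
  sum (λ i → u i ∸ v i)                 ∎)
  where open ≡-Reasoning

sum-const-1 : ∀ n → sum {n} (λ _ → 1) ≡ n
sum-const-1 zero    = refl
sum-const-1 (suc n) = cong suc (sum-const-1 n)

infix 4 [_<_]

[_<_] : ℕ → ℕ → ℕ
[ _     < zero  ] = 0
[ zero  < suc _ ] = 1
[ suc c < suc b ] = [ c < b ]

[<]≡1 : ∀ {c b} → c < b → [ c < b ] ≡ 1
[<]≡1 {zero}  {suc b} _         = refl
[<]≡1 {suc c} {suc b} (s≤s c<b) = [<]≡1 c<b

[<]-irrefl : ∀ c → [ c < c ] ≡ 0
[<]-irrefl zero    = refl
[<]-irrefl (suc c) = [<]-irrefl c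

[<]≤1 : ∀ c b → [ c < b ] ≤ 1
[<]≤1 c       zero    = z≤n
[<]≤1 zero    (suc b) = ≤-refl
[<]≤1 (suc c) (suc b) = [<]≤1 c b

[<]-monoʳ : ∀ c {a b} → a ≤ b → [ c < a ] ≤ [ c < b ]
[<]-monoʳ c       z≤n       = z≤n
[<]-monoʳ zero    (s≤s a≤b) = ≤-refl
[<]-monoʳ (suc c) (s≤s a≤b) = [<]-monoʳ c a≤b

sum-[<] : ∀ {N B} → B ≤ N → sum {N} (λ i → [ toℕ i < B ]) ≡ B
sum-[<] {N}     {zero}  _         = sum-replicate-zero N
sum-[<] {suc N} {suc B} (s≤s B≤N) = cong suc (sum-[<] B≤N)

-- between a b c = 1 exactly when a ≤ c < b.
between : ℕ → ℕ → ℕ → ℕ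
between a b c = [ c < b ] ∸ [ c < a ]

sum-between : ∀ {N a b} → a ≤ b → b ≤ N → sum {N} (λ i → between a b (toℕ i)) ≡ b ∸ a
sum-between {N} {a} {b} a≤b b≤N = begin
  sum {N} (λ i → between a b (toℕ i))
    ≡⟨ sum-∸ {N} (λ i → [<]-monoʳ (toℕ i) a≤b) ⟩
  sum {N} (λ i → [ toℕ i < b ]) ∸ sum {N} (λ i → [ toℕ i < a ])
    ≡⟨ cong₂ _∸_ (sum-[<] b≤N) (sum-[<] (≤-trans a≤b b≤N)) ⟩
  b ∸ a
    ∎
  where open ≡-Reasoning

injective⇒surjective : ∀ {n} {h : Fin n → Fin n} → Injective _≡_ _≡_ h → ∀ k → ∃ λ i → h i ≡ k
injective⇒surjective {suc n} {h} h-inj k with any? (λ i → h i ≟ k)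
... | yes hit = hit
... | no miss = contradiction (injective⇒≤ h′-inj) 1+n≰n
  where
  k≢h : ∀ i → k ≢ h i
  k≢h i k≡hi = miss (i , sym k≡hi)
  h′ : Fin (suc n) → Fin n
  h′ i = punchOut (k≢h i)
  h′-inj : Injective _≡_ _≡_ h′
  h′-inj {i} {j} eq = h-inj (punchOut-injective (k≢h i) (k≢h j) eq)

to-injective : ∀ {A B : Set} (σ : A ↔ B) → Injective _≡_ _≡_ (Inverse.to σ)
to-injective σ = Injection.injective (↔⇒↣ σ)

from-injective : ∀ {A B : Set} (σ : A ↔ B) → Injective _≡_ _≡_ (Inverse.from σ)
from-injective σ = to-injective (↔-sym σ)

module Ranking {n} {A : Set} (σ : Fin n ↔ A) (r : A → ℕ) (r-injective : Injective _≡_ _≡_ r) where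

  open Inverse σ using (to; from; strictlyInverseˡ)

  rank : A → ℕ
  rank a = sum (λ j → [ r (to j) < r a ])

  private
    [<]-at : ∀ a b → [ r (to (from a)) < r b ] ≡ [ r a < r b ]
    [<]-at a b = cong (λ z → [ r z < r b ]) (strictlyInverseˡ a)

    [<]-at-self : ∀ a → [ r (to (from a)) < r a ] ≡ 0
    [<]-at-self a = trans ([<]-at a a) ([<]-irrefl (r a))

  rank-< : ∀ {a b} → r a < r b → rank a < rank b
  rank-< {a} {b} ra<rb = sum-mono-< (λ j → [<]-monoʳ (r (to j)) (<⇒≤ ra<rb)) (from a)
    (subst₂ _<_ (sym ([<]-at-self a)) (sym (trans ([<]-at a b) ([<]≡1 ra<rb))) z<s)

  rank<n : ∀ a → rank a < n
  rank<n a = subst (rank a <_) (sum-const-1 n) (sum-mono-< (λ j → [<]≤1 (r (to j)) (r a)) (from a)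
    (subst (_< 1) (sym ([<]-at-self a)) z<s))

  rank-<-reflects : ∀ {a b} → rank a < rank b → r a < r b
  rank-<-reflects {a} {b} rka<rkb with <-cmp (r a) (r b)
  ... | tri< ra<rb _ _ = ra<rb
  ... | tri≈ _ ra≡rb _ = contradiction (cong rank (r-injective ra≡rb)) (<⇒≢ rka<rkb)
  ... | tri> _ _ rb<ra = contradiction (rank-< rb<ra) (<⇒≯ rka<rkb)

  rank-injective : Injective _≡_ _≡_ rank
  rank-injective {a} {b} rka≡rkb with <-cmp (r a) (r b)
  ... | tri< ra<rb _ _ = contradiction rka≡rkb (<⇒≢ (rank-< ra<rb))
  ... | tri≈ _ ra≡rb _ = r-injective ra≡rb
  ... | tri> _ _ rb<ra = contradiction (sym rka≡rkb) (<⇒≢ (rank-< rb<ra))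

  rank-gap : ∀ {a b} → r a ≤ r b → rank b ∸ rank a ≡ sum (λ j → between (r a) (r b) (r (to j)))
  rank-gap ra≤rb = sym (sum-∸ (λ j → [<]-monoʳ (r (to j)) ra≤rb))

  private
    position : A → Fin n
    position a = fromℕ< (rank<n a)

    position-injective : Injective _≡_ _≡_ position
    position-injective {a} {b} eq =
      rank-injective (trans (sym (toℕ-fromℕ< (rank<n a))) (trans (cong toℕ eq) (toℕ-fromℕ< (rank<n b))))

    occupant : ∀ k → ∃ λ j → position (to j) ≡ k
    occupant = injective⇒surjective (to-injective σ ∘ position-injective)

  sortBy : Fin n ↔ A
  sortBy = mk↔ₛ′ (to ∘ proj₁ ∘ occupant) position
    (λ a → position-injective (proj₂ (occupant (position a))))
    (proj₂ ∘ occupant)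

  toℕ-from-sortBy : ∀ a → toℕ (Inverse.from sortBy a) ≡ rank a
  toℕ-from-sortBy a = toℕ-fromℕ< (rank<n a)

pos-injective : ∀ {K} (c : CSeq K) → Injective _≡_ _≡_ (pos c)
pos-injective c = from-injective (x c) ∘ toℕ-injective

pos<len : ∀ {K} (c : CSeq K) a → pos c a < len K
pos<len c a = toℕ<n (Inverse.from (x c) a)

EdgesAfter : (K : Graph) → (Elt K → ℕ) → Set
EdgesAfter K r = ∀ e →
  r (inj₁ (proj₁ (ends K e))) < r (inj₂ e) × r (inj₁ (proj₂ (ends K e))) < r (inj₂ e)

byRank : (K : Graph) (r : Elt K → ℕ) (r-injective : Injective _≡_ _≡_ r) → EdgesAfter K r → CSeq K
byRank K r r-injective after = record
  { x          = sortBy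
  ; edge-after = Product.map ranked-< ranked-< ∘ after
  }
  where
  open Ranking +↔⊎ r r-injective
  ranked-< : ∀ {a b} → r a < r b → toℕ (Inverse.from sortBy a) < toℕ (Inverse.from sortBy b)
  ranked-< {a} {b} = subst₂ _<_ (sym (toℕ-from-sortBy a)) (sym (toℕ-from-sortBy b)) ∘ rank-<

image? : ∀ {n} {B A : Set} → Fin n ↔ B → DecidableEquality A → (ι : B → A) → ∀ a → Dec (∃ λ b → ι b ≡ a)
image? τ _≟ᴬ_ ι a = map′
  (λ (i , ιτi≡a) → Inverse.to τ i , ιτi≡a)
  (λ (b , ιb≡a) → Inverse.from τ b , trans (cong ι (Inverse.strictlyInverseˡ τ b)) ιb≡a)
  (any? (λ i → ι (Inverse.to τ i) ≟ᴬ a))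

module ExtendRanking {B A : Set} {ι : B → A} (ι-injective : Injective _≡_ _≡_ ι)
  (inImage? : ∀ a → Dec (∃ λ b → ι b ≡ a))
  {r : B → ℕ} (r-injective : Injective _≡_ _≡_ r) {L : ℕ} (r<L : ∀ b → r b < L)
  {code : A → ℕ} (code-injective : Injective _≡_ _≡_ code) where

  extendAt : ∀ a → Dec (∃ λ b → ι b ≡ a) → ℕ
  extendAt a (yes (b , _)) = r b
  extendAt a (no _)        = L + code a

  r̂ : A → ℕ
  r̂ a = extendAt a (inImage? a)

  r̂∘ι : ∀ b → r̂ (ι b) ≡ r b
  r̂∘ι b with inImage? (ι b)
  ... | yes (b′ , ιb′≡ιb) = cong r (ι-injective ιb′≡ιb)
  ... | no ∉              = contradiction (b , refl) ∉

  image-or-above : ∀ a → (∃ λ b → ι b ≡ a) ⊎ L ≤ r̂ a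
  image-or-above a with inImage? a
  ... | yes ∈ = inj₁ ∈
  ... | no _  = inj₂ (m≤m+n L (code a))

  r̂-injective : Injective _≡_ _≡_ r̂
  r̂-injective {a} {a′} eq with inImage? a | inImage? a′
  ... | yes (b , refl) | yes (b′ , refl) = cong ι (r-injective eq)
  ... | yes (b , _)    | no _            = contradiction eq (<⇒≢ (<-≤-trans (r<L b) (m≤m+n L (code a′))))
  ... | no _           | yes (b′ , _)    = contradiction (sym eq) (<⇒≢ (<-≤-trans (r<L b′) (m≤m+n L (code a))))
  ... | no _           | no _            = code-injective (+-cancelˡ-≡ L (code a) (code a′) eq)

module _ {H G : Graph} (s : Subgraph H G) where

  ι : Elt H → Elt G
  ι = Sum.map (f s) (g s)

  ι-injective : Injective _≡_ _≡_ ι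
  ι-injective {inj₁ u} {inj₁ v} eq = cong inj₁ (f-inj s u v (inj₁-injective eq))
  ι-injective {inj₂ d} {inj₂ e} eq = cong inj₂ (g-inj s d e (inj₂-injective eq))

  ends-image : (R : Fin (p G) → Fin (p G) → Set) → Symmetric R → ∀ e →
    R (f s (proj₁ (ends H e))) (f s (proj₂ (ends H e))) ⇔ R (proj₁ (ends G (g s e))) (proj₂ (ends G (g s e)))
  ends-image R R-sym e with g-ends s e
  ... | inj₁ (≡₁ , ≡₂) = mk⇔ (subst₂ R (sym ≡₁) (sym ≡₂)) (subst₂ R ≡₁ ≡₂)
  ... | inj₂ (≡₁ , ≡₂) = mk⇔ (subst₂ R (sym ≡₁) (sym ≡₂) ∘ R-sym) (R-sym ∘ subst₂ R ≡₁ ≡₂)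

  cost-mono : (cH : CSeq H) (cG : CSeq G) →
    (∀ a b → pos cH a < pos cH b → pos cH b ∸ pos cH a ≤ pos cG (ι b) ∸ pos cG (ι a)) →
    cost cH ≤ cost cG
  cost-mono cH cG gap≤ = begin
    sum (edgeCost cH)       ≤⟨ sum-mono-≤ edgeCost≤ ⟩
    sum (edgeCost cG ∘ g s) ≤⟨ sum-inject-≤ (edgeCost cG) (g-inj s _ _) ⟩
    sum (edgeCost cG)       ∎
    where
    open ≤-Reasoning
    edgeCost≤ : ∀ e → edgeCost cH e ≤ edgeCost cG (g s e)
    edgeCost≤ e = Equivalence.to (ends-image R R-sym e)
      (+-mono-≤ (gap≤ _ _ (proj₁ (edge-after cH e))) (gap≤ _ _ (proj₂ (edge-after cH e))))
      where
      gapG : Fin (p G) → ℕ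
      gapG v = pos cG (inj₂ (g s e)) ∸ pos cG (inj₁ v)
      R : Fin (p G) → Fin (p G) → Set
      R u v = edgeCost cH e ≤ gapG u + gapG v
      R-sym : Symmetric R
      R-sym {u} {v} = subst (edgeCost cH e ≤_) (+-comm (gapG u) (gapG v))

  module Restriction (cG : CSeq G) where

    r : Elt H → ℕ
    r = pos cG ∘ ι

    r-injective : Injective _≡_ _≡_ r
    r-injective = ι-injective ∘ pos-injective cG

    after : EdgesAfter H r
    after e = Equivalence.from (ends-image R Product.swap e) (edge-after cG (g s e))
      where
      R : Fin (p G) → Fin (p G) → Set
      R u v = pos cG (inj₁ u) < pos cG (inj₂ (g s e)) × pos cG (inj₁ v) < pos cG (inj₂ (g s e))

    restrict : CSeq H
    restrict = byRank H r r-injective after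

    open Ranking +↔⊎ r r-injective

    gap≤ : ∀ a b → pos restrict a < pos restrict b → pos restrict b ∸ pos restrict a ≤ r b ∸ r a
    gap≤ a b lt = begin
      pos restrict b ∸ pos restrict a ≡⟨ cong₂ _∸_ (toℕ-from-sortBy b) (toℕ-from-sortBy a) ⟩
      rank b ∸ rank a                 ≡⟨ rank-gap {a} {b} ra≤rb ⟩
      sum {len H} (W ∘ h)             ≤⟨ sum-inject-≤ W h-injective ⟩
      sum {len G} W                   ≡⟨ sum-between ra≤rb (<⇒≤ (pos<len cG (ι b))) ⟩
      r b ∸ r a                       ∎
      where
      open ≤-Reasoning
      ra≤rb : r a ≤ r b
      ra≤rb = <⇒≤ (rank-<-reflects {a} {b} (subst₂ _<_ (toℕ-from-sortBy a) (toℕ-from-sortBy b) lt))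
      W : Fin (len G) → ℕ
      W i = between (r a) (r b) (toℕ i)
      h : Fin (len H) → Fin (len G)
      h = Inverse.from (x cG) ∘ ι ∘ Inverse.to +↔⊎
      h-injective : Injective _≡_ _≡_ h
      h-injective = to-injective +↔⊎ ∘ r-injective ∘ cong toℕ

    cost-restrict : cost restrict ≤ cost cG
    cost-restrict = cost-mono restrict cG gap≤

  module Extension (spanning : Spanning s) (cH : CSeq H) where

    open ExtendRanking ι-injective (image? +↔⊎ (≡-dec _≟_ _≟_) ι) (pos-injective cH) (pos<len cH)
      {code = toℕ ∘ Inverse.from +↔⊎} (from-injective +↔⊎ ∘ toℕ-injective)

    r̂∘ι-< : ∀ {a b} → pos cH a < pos cH b → r̂ (ι a) < r̂ (ι b)
    r̂∘ι-< {a} {b} = subst₂ _<_ (sym (r̂∘ι a)) (sym (r̂∘ι b))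

    vertex-below : ∀ v → r̂ (inj₁ v) < len H
    vertex-below v with spanning v
    ... | u , refl = subst (_< len H) (sym (r̂∘ι (inj₁ u))) (pos<len cH (inj₁ u))

    after : EdgesAfter G r̂
    after e′ with image-or-above (inj₂ e′)
    ... | inj₁ (inj₂ e , refl) =
      Equivalence.to (ends-image R Product.swap e) (Product.map r̂∘ι-< r̂∘ι-< (edge-after cH e))
      where
      R : Fin (p G) → Fin (p G) → Set
      R u v = r̂ (inj₁ u) < r̂ (inj₂ (g s e)) × r̂ (inj₁ v) < r̂ (inj₂ (g s e))
    ... | inj₂ L≤r̂e′ = below-e′ (proj₁ (ends G e′)) , below-e′ (proj₂ (ends G e′))
      where
      below-e′ : ∀ v → r̂ (inj₁ v) < r̂ (inj₂ e′)
      below-e′ v = <-≤-trans (vertex-below v) L≤r̂e′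

    extend : CSeq G
    extend = byRank G r̂ r̂-injective after

    open Ranking +↔⊎ r̂ r̂-injective

    gap≤ : ∀ a b → pos cH a < pos cH b → pos cH b ∸ pos cH a ≤ pos extend (ι b) ∸ pos extend (ι a)
    gap≤ a b lt = begin
      pos cH b ∸ pos cH a                 ≡⟨ cong₂ _∸_ (r̂∘ι b) (r̂∘ι a) ⟨
      r̂ (ι b) ∸ r̂ (ι a)                   ≡⟨ sum-between r̂ιa≤r̂ιb r̂ιb≤len ⟨
      sum {len H} (window ∘ toℕ)          ≡⟨ sum-cong-≗ (cong window ∘ sym ∘ r̂∘h) ⟩
      sum {len H} (W ∘ h)                 ≤⟨ sum-inject-≤ W h-injective ⟩
      sum {len G} W                       ≡⟨ rank-gap {ι a} {ι b} r̂ιa≤r̂ιb ⟨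
      rank (ι b) ∸ rank (ι a)             ≡⟨ cong₂ _∸_ (toℕ-from-sortBy (ι b)) (toℕ-from-sortBy (ι a)) ⟨
      pos extend (ι b) ∸ pos extend (ι a) ∎
      where
      open ≤-Reasoning
      r̂ιa≤r̂ιb : r̂ (ι a) ≤ r̂ (ι b)
      r̂ιa≤r̂ιb = <⇒≤ (r̂∘ι-< lt)
      r̂ιb≤len : r̂ (ι b) ≤ len H
      r̂ιb≤len = subst (_≤ len H) (sym (r̂∘ι b)) (<⇒≤ (pos<len cH b))
      window : ℕ → ℕ
      window = between (r̂ (ι a)) (r̂ (ι b))
      W : Fin (len G) → ℕ
      W = window ∘ r̂ ∘ Inverse.to +↔⊎
      h : Fin (len H) → Fin (len G)
      h = Inverse.from +↔⊎ ∘ ι ∘ Inverse.to (x cH)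
      h-injective : Injective _≡_ _≡_ h
      h-injective = to-injective (x cH) ∘ ι-injective ∘ from-injective +↔⊎
      r̂∘h : ∀ i → r̂ (Inverse.to +↔⊎ (h i)) ≡ toℕ i
      r̂∘h i = ≡.begin
        r̂ (Inverse.to +↔⊎ (h i))        ≡.≡⟨ cong r̂ (Inverse.strictlyInverseˡ +↔⊎ _) ⟩
        r̂ (ι (Inverse.to (x cH) i))      ≡.≡⟨ r̂∘ι _ ⟩
        pos cH (Inverse.to (x cH) i)     ≡.≡⟨ cong toℕ (Inverse.strictlyInverseʳ (x cH) i) ⟩
        toℕ i                            ≡.∎
        where module ≡ = ≡-Reasoning

    cost-extend : cost cH ≤ cost extend
    cost-extend = cost-mono cH extend gap≤

lemma6 : (H G : Graph) (s : Subgraph H G) →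
    (∀ (mH mG : ℕ) → IsMinCost H mH → IsMinCost G mG → mH ≤ mG) ×
    (Spanning s → ∀ (MH MG : ℕ) → IsMaxCost H MH → IsMaxCost G MG → MH ≤ MG)
lemma6 H G s = minCost-mono , maxCost-mono
  where
  minCost-mono : ∀ (mH mG : ℕ) → IsMinCost H mH → IsMinCost G mG → mH ≤ mG
  minCost-mono mH mG (_ , mH≤) ((cG , refl) , _) = ≤-trans (mH≤ restrict) cost-restrict
    where open Restriction s cG
  maxCost-mono : Spanning s → ∀ (MH MG : ℕ) → IsMaxCost H MH → IsMaxCost G MG → MH ≤ MG
  maxCost-mono spanning MH MG ((cH , refl) , _) (_ , ≤MG) = ≤-trans cost-extend (≤MG extend)
    where open Extension s spanning cH
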